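{- If $G=(\Gamma,R,B)$ is a chromatically invariant $2$-edge-coloured graph in which every vertex is incident with a red edge and a blue edge, then $\Gamma$ is a join.
   Context: All graphs are finite, simple, with nonempty vertex set. A graph $\Gamma$ is a join if $V(\Gamma)$ has a partition $\{X,Y\}$ into two nonempty sets with $xy\in E(\Gamma)$ for all $x\in X,y\in Y$. A $2$-edge-coloured graph is a triple $G=(\Gamma,R,B)$ with $R,B\subseteq E(\Gamma)$, $R\cap B=\emptyset$, $R\cup B=E(\Gamma)$ (red and blue edges). A $k$-colouring of $G$ is a proper vertex colouring $c:V(\Gamma)\to\{1,\dots,k\}$ of $\Gamma$ such that for every $ux\in R$ and $vy\in B$ (either endpoint may play the role of $u$, resp. $v$), $c(u)=c(v)$ implies $c(x)\ne c(y)$. $P(G,\lambda)$ is the polynomial whose value at each non-negative integer $k$ is the number of $k$-colourings of $G$. $G$ is chromatically invariant if $P(G,\lambda)=P(\Gamma,\lambda)$, the usual chromatic polynomial of $\Gamma$. -}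

module Defs where

open import Data.Bool using (Bool; true; false; _∨_)
open import Data.Nat using (ℕ; zero; suc)
open import Data.Fin using (Fin)
open import Data.Fin.Properties using (all?; _≟_)
open import Data.List using (List; []; _∷_; map; concatMap; length; filter)
open import Data.List.Base using () renaming (allFin to allFinL)
open import Data.Vec.Functional using () renaming (_∷_ to _◂_)
open import Data.Sum using (_⊎_)
open import Data.Product using (∃; _×_; Σ)
open import Relation.Nullary using (¬_; Dec; yes; no)
open import Relation.Nullary.Decidable using (_⊎-dec_; _×-dec_; ¬?; _→-dec_)
open import Relation.Binary.PropositionalEquality using (_≡_; _≢_)
open import Data.Bool.Properties using () renaming (_≟_ to _≟ᵇ_)

-- A 2-edge-coloured (finite, simple) graph on vertex set Fin n.
-- The red and blue edge sets are given as symmetric, irreflexive,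
-- disjoint Boolean adjacency relations; E(Γ) = R ∪ B.
record TwoEdgeColoured (n : ℕ) : Set where
  field
    red  : Fin n → Fin n → Bool
    blue : Fin n → Fin n → Bool
    red-symm   : ∀ u v → red u v ≡ red v u
    blue-symm  : ∀ u v → blue u v ≡ blue v u
    red-irrefl  : ∀ u → red u u ≡ false
    blue-irrefl : ∀ u → blue u u ≡ false
    disjoint : ∀ u v → red u v ≡ true → blue u v ≡ false

  Red : Fin n → Fin n → Set
  Red u v = red u v ≡ true

  Blue : Fin n → Fin n → Set
  Blue u v = blue u v ≡ true

  Adj : Fin n → Fin n → Set
  Adj u v = Red u v ⊎ Blue u v

  IsProper : {k : ℕ} → (Fin n → Fin k) → Set
  IsProper c = ∀ u v → Adj u v → c u ≢ c v

  -- k-colouring of G: proper, and for every red edge ux and blue edge vy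
  -- (ordered pairs, so either endpoint plays the role of u resp. v),
  -- c(u) = c(v) implies c(x) ≠ c(y).
  IsGColouring : {k : ℕ} → (Fin n → Fin k) → Set
  IsGColouring c = IsProper c ×
    (∀ u x v y → Red u x → Blue v y → c u ≡ c v → c x ≢ c y)

  adj? : ∀ u v → Dec (Adj u v)
  adj? u v = (red u v ≟ᵇ true) ⊎-dec (blue u v ≟ᵇ true)

  isProper? : {k : ℕ} → (c : Fin n → Fin k) → Dec (IsProper c)
  isProper? c = all? λ u → all? λ v → adj? u v →-dec ¬? (c u ≟ c v)

  isGColouring? : {k : ℕ} → (c : Fin n → Fin k) → Dec (IsGColouring c)
  isGColouring? c = isProper? c ×-dec
    (all? λ u → all? λ x → all? λ v → all? λ y →
      (red u x ≟ᵇ true) →-dec ((blue v y ≟ᵇ true) →-dec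
        ((c u ≟ c v) →-dec ¬? (c x ≟ c y))))

-- enumeration of all functions Fin n → Fin k (each exactly once)
allFunctions : (n k : ℕ) → List (Fin n → Fin k)
allFunctions zero    k = (λ ()) ∷ []
allFunctions (suc n) k =
  concatMap (λ i → map (λ f → i ◂ f) (allFunctions n k)) (allFinL k)

module _ {n : ℕ} (G : TwoEdgeColoured n) where
  open TwoEdgeColoured G

  chromΓ : ℕ → ℕ
  chromΓ k = length (filter isProper? (allFunctions n k))

  chromG : ℕ → ℕ
  chromG k = length (filter isGColouring? (allFunctions n k))

  -- P(G,λ) = P(Γ,λ) as polynomials; two polynomials are equal iff they
  -- agree at every non-negative integer, and both are defined by these values.
  ChromaticallyInvariant : Set
  ChromaticallyInvariant = ∀ k → chromG k ≡ chromΓ k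

  -- Γ is a join: a partition {X, Y} (X = {v | inX v ≡ true}) into two
  -- nonempty sets with every x ∈ X adjacent to every y ∈ Y.
  IsJoin : Set
  IsJoin = Σ (Fin n → Bool) λ inX →
    (∃ λ x → inX x ≡ true) × (∃ λ y → inX y ≡ false) ×
    (∀ x y → inX x ≡ true → inX y ≡ false → Adj x y)

  RedBlueAtEveryVertex : Set
  RedBlueAtEveryVertex = ∀ v → (∃ λ w → Red v w) × (∃ λ w → Blue v w)

module Submission where

-- Write x ≁ y for "x and y are not adjacent in Γ" (this includes x = y).
-- Call a red edge ux and a blue edge vy a clash if u ≁ v and x ≁ y; the
-- definition of a k-colouring of G says precisely that a colouring may not
-- give u, v one common colour and x, y another.
--
-- 1. Chromatic invariance rules out clashes.  Given a clash, recolour v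
--    with u and y with x and keep every other vertex's own name as colour.
--    This n-colouring is proper (the classes {u,v}, {x,y} and the singletons
--    are independent) but not a colouring of G, so P(G,n) < P(Γ,n).
--
-- 2. Without clashes, every vertex x with a red and a blue neighbour yields
--    a join or a vertex of strictly smaller degree.  A defect of x towards
--    a colour is a non-neighbour p of x missing some neighbour of x of that
--    colour.  With no blue defect, the blue neighbours of x form one side of
--    a join, and likewise for red.  Defects towards both colours produce a
--    witness: a non-neighbour p of x missing a red and a blue neighbour of
--    x; then N(p) ⊊ N(x).  Descending on the degree proves the theorem.

open import Data.Bool using (Bool; true; false)
open import Data.Bool.Properties using () renaming (_≟_ to _≟ᵇ_)
open import Data.Empty using (⊥; ⊥-elim)
open import Data.Fin using (Fin; zero; suc)
open import Data.Fin.Properties using (_≟_; any?)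
open import Data.List using ([]; _∷_; filter; length)
open import Data.List.Base using (allFin)
open import Data.List.Relation.Unary.Any as Any using (Any; here; there)
open import Data.List.Relation.Unary.Any.Properties using (map⁺; concat⁺; tabulate⁺)
open import Data.Nat using (ℕ; zero; suc; _≤_; _<_; s≤s; z≤n)
open import Data.Nat.Properties using (≤-refl; m≤n⇒m≤1+n; <-≤-trans; <-irrefl)
open import Data.Product using (∃; _×_; _,_; proj₁)
open import Data.Sum using (_⊎_; inj₁; inj₂)
open import Data.Vec.Functional using () renaming (_∷_ to _◂_)
open import Function using (_∘_)
open import Relation.Nullary using (¬_; Dec; yes; no)
open import Relation.Nullary.Decidable using (_×-dec_; ¬?; decidable-stable)
open import Relation.Unary using (Pred; Decidable)
open import Relation.Binary.PropositionalEquality using (_≡_; _≢_; refl; sym; trans)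

open import Defs

module _ {a p} {A : Set a} {P Q : Pred A p} (P? : Decidable P) (Q? : Decidable Q)
         (P⇒Q : ∀ {z} → P z → Q z) where

  filter-length-mono : ∀ xs → length (filter P? xs) ≤ length (filter Q? xs)
  filter-length-mono []       = z≤n
  filter-length-mono (z ∷ xs) with P? z | Q? z
  ... | yes _  | yes _  = s≤s (filter-length-mono xs)
  ... | yes pz | no ¬qz = ⊥-elim (¬qz (P⇒Q pz))
  ... | no _   | yes _  = m≤n⇒m≤1+n (filter-length-mono xs)
  ... | no _   | no _   = filter-length-mono xs

  filter-length-strict : ∀ xs → Any (λ z → Q z × ¬ P z) xs →
                         length (filter P? xs) < length (filter Q? xs)
  filter-length-strict (z ∷ xs) (here (qz , ¬pz)) with P? z | Q? z
  ... | yes pz | _      = ⊥-elim (¬pz pz)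
  ... | no _   | yes _  = s≤s (filter-length-mono xs)
  ... | no _   | no ¬qz = ⊥-elim (¬qz qz)
  filter-length-strict (z ∷ xs) (there later) with P? z | Q? z
  ... | yes _  | yes _  = s≤s (filter-length-strict xs later)
  ... | yes pz | no ¬qz = ⊥-elim (¬qz (P⇒Q pz))
  ... | no _   | yes _  = m≤n⇒m≤1+n (filter-length-strict xs later)
  ... | no _   | no _   = filter-length-strict xs later

-- Every function Fin n → Fin k is enumerated by allFunctions n k, up to
-- pointwise equality (the only equality available for functions).
allFunctions-complete : ∀ n k (c : Fin n → Fin k) →
                        Any (λ g → ∀ i → g i ≡ c i) (allFunctions n k)
allFunctions-complete zero    k c = here (λ ())
allFunctions-complete (suc n) k c =
  concat⁺ (map⁺ (tabulate⁺ (c zero)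
    (map⁺ (Any.map extend (allFunctions-complete n k (c ∘ suc))))))
  where
  extend : ∀ {g} → (∀ i → g i ≡ c (suc i)) → ∀ i → (c zero ◂ g) i ≡ c i
  extend g≗c zero    = refl
  extend g≗c (suc i) = g≗c i

descent : ∀ {a b} {A : Set a} {P : Set b} (μ : A → ℕ) →
          (∀ x → P ⊎ ∃ λ y → μ y < μ x) → A → P
descent {P = P} μ step start = below (suc (μ start)) start ≤-refl
  where
  below : ∀ bound x → μ x < bound → P
  below (suc bound) x (s≤s μx≤bound) with step x
  ... | inj₁ done       = done
  ... | inj₂ (y , μy<μx) = below bound y (<-≤-trans μy<μx μx≤bound)

module _ {n : ℕ} (G : TwoEdgeColoured n) where
  open TwoEdgeColoured G

  private
    true≢false : true ≢ false
    true≢false ()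

  red-sym : ∀ {a b} → Red a b → Red b a
  red-sym {a} {b} ab = trans (red-symm b a) ab

  blue-sym : ∀ {a b} → Blue a b → Blue b a
  blue-sym {a} {b} ab = trans (blue-symm b a) ab

  adj-sym : ∀ {a b} → Adj a b → Adj b a
  adj-sym (inj₁ ab) = inj₁ (red-sym ab)
  adj-sym (inj₂ ab) = inj₂ (blue-sym ab)

  ≁-sym : ∀ {a b} → ¬ Adj a b → ¬ Adj b a
  ≁-sym a≁b = a≁b ∘ adj-sym

  adj-irrefl : ∀ a → ¬ Adj a a
  adj-irrefl a (inj₁ aa) = true≢false (trans (sym aa) (red-irrefl a))
  adj-irrefl a (inj₂ aa) = true≢false (trans (sym aa) (blue-irrefl a))

  adj-by-contradiction : ∀ {a b} → ¬ ¬ Adj a b → Adj a b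
  adj-by-contradiction {a} {b} = decidable-stable (adj? a b)

  NoClash : Set
  NoClash = ∀ {u x v y} → Red u x → Blue v y → ¬ Adj u v → ¬ Adj x y → ⊥

  module _ {k} {f g : Fin n → Fin k} (f≗g : ∀ i → f i ≡ g i) where
    private
      transport : ∀ {a b} → g a ≡ g b → f a ≡ f b
      transport {a} {b} ga≡gb = trans (f≗g a) (trans ga≡gb (sym (f≗g b)))

    proper-resp : IsProper f → IsProper g
    proper-resp f-proper a b a~b ga≡gb = f-proper a b a~b (transport ga≡gb)

    gColouring-resp : IsGColouring f → IsGColouring g
    gColouring-resp (f-proper , f-rule) =
      proper-resp f-proper ,
      λ u x v y ux vy gu≡gv gx≡gy → f-rule u x v y ux vy (transport gu≡gv) (transport gx≡gy)

  module ClashColouring {u x v y} (ux : Red u x) (vy : Blue v y)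
                        (u≁v : ¬ Adj u v) (x≁y : ¬ Adj x y) where

    colour : Fin n → Fin n
    colour w with w ≟ v | w ≟ y
    ... | yes _ | _     = u
    ... | no _  | yes _ = x
    ... | no _  | no _  = w

    data Coloured (w : Fin n) : Fin n → Set where
      at-v : w ≡ v → Coloured w u
      at-y : w ≡ y → Coloured w x
      kept : w ≢ v → w ≢ y → Coloured w w

    colour-view : ∀ w → Coloured w (colour w)
    colour-view w with w ≟ v | w ≟ y
    ... | yes w≡v | _       = at-v w≡v
    ... | no _    | yes w≡y = at-y w≡y
    ... | no w≢v  | no w≢y  = kept w≢v w≢y

    u≢x : u ≢ x
    u≢x refl = adj-irrefl u (inj₁ ux)

    same-colour-≁ : ∀ {a b ca cb} → Coloured a ca → Coloured b cb → ca ≡ cb → ¬ Adj a b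
    same-colour-≁ (at-v refl)  (at-v refl)  _    = adj-irrefl v
    same-colour-≁ (at-v refl)  (at-y refl)  u≡x  = ⊥-elim (u≢x u≡x)
    same-colour-≁ (at-v refl)  (kept _ _)   refl = ≁-sym u≁v
    same-colour-≁ (at-y refl)  (at-v refl)  x≡u  = ⊥-elim (u≢x (sym x≡u))
    same-colour-≁ (at-y refl)  (at-y refl)  _    = adj-irrefl y
    same-colour-≁ (at-y refl)  (kept _ _)   refl = ≁-sym x≁y
    same-colour-≁ (kept _ _)   (at-v refl)  refl = u≁v
    same-colour-≁ (kept _ _)   (at-y refl)  refl = x≁y
    same-colour-≁ {a} (kept _ _) (kept _ _) refl = adj-irrefl a

    proper : IsProper colour
    proper a b a~b ca≡cb = same-colour-≁ (colour-view a) (colour-view b) ca≡cb a~b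

    colour-u : colour u ≡ u
    colour-u = from (colour-view u)
      where
      from : ∀ {c} → Coloured u c → c ≡ u
      from (at-v _)    = refl
      from (at-y refl) = ⊥-elim (x≁y (inj₁ (red-sym ux)))
      from (kept _ _)  = refl

    colour-v : colour v ≡ u
    colour-v = from (colour-view v)
      where
      from : ∀ {c} → Coloured v c → c ≡ u
      from (at-v _)      = refl
      from (at-y refl)   = ⊥-elim (adj-irrefl v (inj₂ vy))
      from (kept v≢v _)  = ⊥-elim (v≢v refl)

    colour-x : colour x ≡ x
    colour-x = from (colour-view x)
      where
      from : ∀ {c} → Coloured x c → c ≡ x
      from (at-v refl) = ⊥-elim (u≁v (inj₁ ux))
      from (at-y _)    = refl
      from (kept _ _)  = refl

    colour-y : colour y ≡ x
    colour-y = from (colour-view y)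
      where
      from : ∀ {c} → Coloured y c → c ≡ x
      from (at-v refl)  = ⊥-elim (adj-irrefl y (inj₂ vy))
      from (at-y _)     = refl
      from (kept _ y≢y) = ⊥-elim (y≢y refl)

    not-G-colouring : ¬ IsGColouring colour
    not-G-colouring (_ , rule) =
      rule u x v y ux vy (trans colour-u (sym colour-v)) (trans colour-x (sym colour-y))

  -- Part 1: a clash colouring is counted by P(Γ,n) but not by P(G,n).
  invariant⇒no-clash : ChromaticallyInvariant G → NoClash
  invariant⇒no-clash invariant ux vy u≁v x≁y = <-irrefl (invariant n) fewer
    where
    open ClashColouring ux vy u≁v x≁y

    proper-not-G : ∀ {g} → (∀ i → g i ≡ colour i) → IsProper g × ¬ IsGColouring g
    proper-not-G g≗c =
      proper-resp (sym ∘ g≗c) proper , not-G-colouring ∘ gColouring-resp g≗c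

    fewer : chromG G n < chromΓ G n
    fewer = filter-length-strict isGColouring? isProper? proj₁ (allFunctions n n)
              (Any.map proper-not-G (allFunctions-complete n n colour))

  degree : Fin n → ℕ
  degree a = length (filter (adj? a) (allFin n))

  Defect : (Fin n → Fin n → Bool) → Fin n → Set
  Defect col x = ∃ λ p → ∃ λ c → ¬ Adj x p × col x c ≡ true × ¬ Adj p c

  defect? : ∀ col x → Dec (Defect col x)
  defect? col x = any? λ p → any? λ c →
    ¬? (adj? x p) ×-dec (col x c ≟ᵇ true) ×-dec ¬? (adj? p c)

  Witness : Fin n → Set
  Witness x = ∃ λ p → ∃ λ r → ∃ λ b →
    ¬ Adj x p × Red x r × Blue x b × ¬ Adj p r × ¬ Adj p b

  side-join : ∀ col {x c} → col x c ≡ true → col x x ≡ false →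
              (∀ {u w} → col x u ≡ true → col x w ≡ false → Adj x w → Adj u w) →
              ¬ Defect col x → IsJoin G
  side-join col {x} {c} xc ¬xx other-nbrs no-defect =
    col x , (c , xc) , (x , ¬xx) , across
    where
    across : ∀ u w → col x u ≡ true → col x w ≡ false → Adj u w
    across u w xu xw = adj-by-contradiction λ u≁w → case (adj? x w) u≁w
      where
      case : Dec (Adj x w) → ¬ Adj u w → ⊥
      case (yes x~w) u≁w = u≁w (other-nbrs xu xw x~w)
      case (no x≁w)  u≁w = no-defect (w , u , x≁w , xu , ≁-sym u≁w)

  module _ (no-clash : NoClash) where

    red-blue-adjacent : ∀ {x r b} → Red x r → Blue x b → Adj r b
    red-blue-adjacent {x} xr xb =
      adj-by-contradiction (no-clash xr xb (adj-irrefl x))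

    non-nbr-blue : ∀ {x p b} → ¬ Adj x p → Blue x b → Adj p b → Blue p b
    non-nbr-blue {b = b} x≁p xb (inj₁ pb) = ⊥-elim (no-clash pb xb (≁-sym x≁p) (adj-irrefl b))
    non-nbr-blue _ _ (inj₂ pb) = pb

    non-nbr-red : ∀ {x q r} → ¬ Adj x q → Red x r → Adj q r → Red q r
    non-nbr-red _ _ (inj₁ qr) = qr
    non-nbr-red {r = r} x≁q xr (inj₂ qr) = ⊥-elim (no-clash xr qr x≁q (adj-irrefl r))

    blue-side-join : ∀ {x b} → Blue x b → ¬ Defect blue x → IsJoin G
    blue-side-join {x} xb = side-join blue xb (blue-irrefl x) red-nbr
      where
      red-nbr : ∀ {u w} → Blue x u → blue x w ≡ false → Adj x w → Adj u w
      red-nbr xu _  (inj₁ xw) = adj-sym (red-blue-adjacent xw xu)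
      red-nbr xu xw (inj₂ xw′) = ⊥-elim (true≢false (trans (sym xw′) xw))

    red-side-join : ∀ {x r} → Red x r → ¬ Defect red x → IsJoin G
    red-side-join {x} xr = side-join red xr (red-irrefl x) blue-nbr
      where
      blue-nbr : ∀ {u w} → Red x u → red x w ≡ false → Adj x w → Adj u w
      blue-nbr xu xw (inj₁ xw′) = ⊥-elim (true≢false (trans (sym xw′) xw))
      blue-nbr xu _  (inj₂ xw) = red-blue-adjacent xu xw

    -- Defects towards both colours give a witness: otherwise the red
    -- defect p is joined in blue to b, the blue defect q in red to r, and
    -- every possible relation between p and q produces a clash.
    defects⇒witness : ∀ {x} → Defect red x → Defect blue x → Witness x
    defects⇒witness {x} (p , r , x≁p , xr , p≁r) (q , b , x≁q , xb , q≁b)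
      with adj? p b | adj? q r
    ... | no p≁b | _       = p , r , b , x≁p , xr , xb , p≁r , p≁b
    ... | yes _  | no q≁r  = q , r , b , x≁q , xr , xb , q≁r , q≁b
    ... | yes p~b | yes q~r = ⊥-elim (p-vs-q (adj? p q))
      where
      pb : Blue p b
      pb = non-nbr-blue x≁p xb p~b
      rq : Red r q
      rq = red-sym (non-nbr-red x≁q xr q~r)
      p-vs-q : Dec (Adj p q) → ⊥
      p-vs-q (yes (inj₁ pq)) = no-clash pq xb (≁-sym x≁p) q≁b
      p-vs-q (yes (inj₂ pq)) = no-clash rq pq (≁-sym p≁r) (adj-irrefl q)
      p-vs-q (no p≁q)        = no-clash rq pb (≁-sym p≁r) q≁b

    -- a witness has strictly smaller degree: N(p) ⊆ N(x) and r ∈ N(x) ∖ N(p)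
    witness⇒smaller : ∀ {x} → (w : Witness x) → degree (proj₁ w) < degree x
    witness⇒smaller {x} (p , r , b , x≁p , xr , xb , p≁r , p≁b) =
      filter-length-strict (adj? p) (adj? x) nbr-of-x (allFin n)
        (tabulate⁺ r (inj₁ xr , p≁r))
      where
      nbr-of-x : ∀ {s} → Adj p s → Adj x s
      nbr-of-x (inj₁ ps) = adj-by-contradiction λ x≁s →
        no-clash ps (blue-sym xb) p≁b (≁-sym x≁s)
      nbr-of-x (inj₂ ps) = adj-by-contradiction λ x≁s →
        no-clash (red-sym xr) ps (≁-sym p≁r) x≁s

    witness-or-join : ∀ {x r b} → Red x r → Blue x b → Witness x ⊎ IsJoin G
    witness-or-join {x} xr xb with defect? red x | defect? blue x
    ... | no no-red | _           = inj₂ (red-side-join xr no-red)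
    ... | yes _     | no no-blue  = inj₂ (blue-side-join xb no-blue)
    ... | yes red-d | yes blue-d  = inj₁ (defects⇒witness red-d blue-d)

    join-from : RedBlueAtEveryVertex G → Fin n → IsJoin G
    join-from red-blue = descent degree step
      where
      step : ∀ x → IsJoin G ⊎ ∃ λ y → degree y < degree x
      step x with red-blue x
      ... | (r , xr) , (b , xb) with witness-or-join xr xb
      ...   | inj₁ w = inj₂ (proj₁ w , witness⇒smaller w)
      ...   | inj₂ j = inj₁ j

lemma12 : (n : ℕ) → 1 ≤ n → (G : TwoEdgeColoured n) →
    ChromaticallyInvariant G → RedBlueAtEveryVertex G → IsJoin G
lemma12 zero    () G _ _
lemma12 (suc n) _  G invariant red-blue =
  join-from G (invariant⇒no-clash G invariant) red-blue zero
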